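{- For any integer $n\geq 1$, $$\Phi(C_{2n+1})\geq \binom{n+1}{2}.$$
   Context: $C_m$ denotes the cycle with vertices $0,1,\dots,m-1$ and edges $\{i,i+1 \bmod m\}$. For a connected graph $G$, a path system of $G$ is a set consisting of one chosen path in $G$ connecting $a$ and $b$ for each unordered pair $\{a,b\}$ of distinct vertices. A global packing of $(G,\mathcal{P})$ is a map $\omega:\mathcal{P}\to\{1,\dots,k\}$ such that $\omega(P)\neq\omega(P')$ whenever distinct paths $P,P'\in\mathcal{P}$ share at least one edge; $\Phi(G,\mathcal{P})$ is the minimum such $k$, and $\Phi(G)$ is the minimum of $\Phi(G,\mathcal{P})$ over all path systems of $G$. -}

module Defs where

open import Data.Nat using (ℕ; zero; suc; _+_; _*_; NonZero)
open import Data.Nat.DivMod using (_%_)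
open import Data.Fin using (Fin; toℕ; _<_)
open import Data.List using (List; []; _∷_; head; last)
open import Data.List.Relation.Unary.Unique.Propositional using (Unique)
open import Data.Maybe using (just)
open import Data.Product using (Σ; _×_)
open import Data.Sum using (_⊎_)
open import Relation.Binary.PropositionalEquality using (_≡_)
open import Relation.Nullary using (¬_)

CycleAdj : (m : ℕ) → .{{_ : NonZero m}} → Fin m → Fin m → Set
CycleAdj m u v = (toℕ v ≡ suc (toℕ u) % m) ⊎ (toℕ u ≡ suc (toℕ v) % m)

data ConsecIn {V : Set} (x y : V) : List V → Set where
  here  : ∀ {l} → ConsecIn x y (x ∷ y ∷ l)
  there : ∀ {z l} → ConsecIn x y l → ConsecIn x y (z ∷ l)

data IsWalk {V : Set} (Adj : V → V → Set) : List V → Set where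
  []  : IsWalk Adj []
  [_] : ∀ x → IsWalk Adj (x ∷ [])
  _∷_ : ∀ {x y l} → Adj x y → IsWalk Adj (y ∷ l) → IsWalk Adj (x ∷ y ∷ l)

IsPathBetween : {V : Set} (Adj : V → V → Set) → V → V → List V → Set
IsPathBetween Adj a b p =
  IsWalk Adj p × Unique p × head p ≡ just a × last p ≡ just b

SharesEdge : {V : Set} → List V → List V → Set
SharesEdge {V} p q =
  Σ V λ x → Σ V λ y → ConsecIn x y p × (ConsecIn x y q ⊎ ConsecIn y x q)

-- A path system of C_m: for each unordered pair {a,b} of distinct vertices
-- (represented by a < b) one chosen path connecting a and b.
record PathSystem (m : ℕ) .{{_ : NonZero m}} : Set where
  field
    path  : Fin m → Fin m → List (Fin m)
    valid : ∀ a b → a < b → IsPathBetween (CycleAdj m) a b (path a b)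

IsGlobalPacking : (m : ℕ) .{{_ : NonZero m}} → PathSystem m → (k : ℕ) →
                  (Fin m → Fin m → Fin k) → Set
IsGlobalPacking m 𝒫 k ω =
  ∀ a b c d → a < b → c < d → ¬ (a ≡ c × b ≡ d) →
  SharesEdge (PathSystem.path 𝒫 a b) (PathSystem.path 𝒫 c d) →
  ¬ (ω a b ≡ ω c d)

-- Double counting.  Write M = 2n + 1.  Every pair of vertices of C_M is {s, s + δ mod M} for
-- exactly one s < M and 1 ≤ δ ≤ n, and every walk between its ends uses at least δ edges:
-- either it uses all edges of one of the two arcs between the ends, or it misses an edge t of
-- that arc, and then it uses every edge e of the other arc, because t and e cut C_M into two
-- arcs separating the ends.  Summing over all pairs, the paths of a path system pass through
-- edges at least M · C(n+1, 2) times.  Paths through a common edge get distinct colours, so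
-- each of the M edges carries at most k paths, and M · C(n+1, 2) ≤ M · k.

module Submission where

open import Data.Bool.Base using (if_then_else_)
open import Data.Fin using (Fin; toℕ) renaming (_<_ to _<ᶠ_)
open import Data.Fin.Properties using (toℕ<n; toℕ-injective; toℕ-fromℕ<) renaming (_≟_ to _≟ᶠ_)
open import Data.List using (List; []; _∷_; head; last)
open import Data.Maybe using (just)
open import Data.Nat using (ℕ; zero; suc; _+_; _*_; _∸_; _≤_; _<_; z≤n; s≤s; z<s; NonZero)
open import Data.Nat.Combinatorics using (_C_; nC1≡n; nCk+nC[k+1]≡[n+1]C[k+1])
open import Data.Nat.DivMod using (_%_; _mod_; m<n⇒m%n≡m; n%n≡0)
open import Data.Nat.Properties
open import Algebra.Properties.CommutativeSemigroup +-commutativeSemigroup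
  using (interchange; xy∙z≈xz∙y)
open import Data.Product as Prod using (_×_; _,_; proj₁; proj₂; ∃-syntax; uncurry; swap)
open import Data.Product.Properties using (×-≡,≡←≡; ×-≡,≡→≡; ≡-dec)
open import Data.Sum as Sum using (_⊎_; inj₁; inj₂)
open import Function using (id; flip; _∘′_)
open import Relation.Binary.Definitions using (DecidableEquality)
open import Relation.Binary.PropositionalEquality
open import Relation.Nullary using (Dec; yes; no; does; ¬_; ¬?; contradiction; _×-dec_; _⊎-dec_)
open import Relation.Nullary.Decidable using (decidable-stable)
open import Relation.Unary using (Decidable)

open import Defs

-- Finite sums and indicators

∑ : ℕ → (ℕ → ℕ) → ℕ
∑ zero    f = 0
∑ (suc N) f = ∑ N f + f N

syntax ∑ N (λ i → x) = ∑[ i < N ] x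

∑-cong : ∀ N {f g : ℕ → ℕ} → (∀ i → f i ≡ g i) → ∑ N f ≡ ∑ N g
∑-cong zero    f≗g = refl
∑-cong (suc N) f≗g = cong₂ _+_ (∑-cong N f≗g) (f≗g N)

∑-mono-≤ : ∀ N {f g : ℕ → ℕ} → (∀ {i} → i < N → f i ≤ g i) → ∑ N f ≤ ∑ N g
∑-mono-≤ zero    f≤g = z≤n
∑-mono-≤ (suc N) f≤g = +-mono-≤ (∑-mono-≤ N (f≤g ∘′ m<n⇒m<1+n)) (f≤g (n<1+n N))

∑-const : ∀ N c → ∑[ i < N ] c ≡ N * c
∑-const zero    c = refl
∑-const (suc N) c = trans (cong (_+ c) (∑-const N c)) (+-comm (N * c) c)

∑-zero : ∀ N → ∑[ i < N ] 0 ≡ 0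
∑-zero N = trans (∑-const N 0) (*-zeroʳ N)

∑-distrib-+ : ∀ N (f g : ℕ → ℕ) → ∑[ i < N ] (f i + g i) ≡ ∑ N f + ∑ N g
∑-distrib-+ zero    f g = refl
∑-distrib-+ (suc N) f g =
  trans (cong (_+ (f N + g N)) (∑-distrib-+ N f g)) (interchange (∑ N f) (∑ N g) (f N) (g N))

∑-comm : ∀ A B (f : ℕ → ℕ → ℕ) → ∑[ i < A ] ∑[ j < B ] f i j ≡ ∑[ j < B ] ∑[ i < A ] f i j
∑-comm zero    B f = sym (∑-zero B)
∑-comm (suc A) B f = begin
  ∑[ i < A ] ∑[ j < B ] f i j + ∑[ j < B ] f A j   ≡⟨ cong (_+ ∑[ j < B ] f A j) (∑-comm A B f) ⟩
  ∑[ j < B ] ∑[ i < A ] f i j + ∑[ j < B ] f A j   ≡⟨ ∑-distrib-+ B (λ j → ∑[ i < A ] f i j) (f A) ⟨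
  ∑[ j < B ] ∑[ i < suc A ] f i j                  ∎
  where open ≡-Reasoning

∑-split : ∀ m n (f : ℕ → ℕ) → ∑ (m + n) f ≡ ∑ m f + ∑[ i < n ] f (m + i)
∑-split m zero    f = trans (cong (λ k → ∑ k f) (+-identityʳ m)) (sym (+-identityʳ (∑ m f)))
∑-split m (suc n) f = begin
  ∑ (m + suc n) f                              ≡⟨ cong (λ k → ∑ k f) (+-suc m n) ⟩
  ∑ (m + n) f + f (m + n)                      ≡⟨ cong (_+ f (m + n)) (∑-split m n f) ⟩
  ∑ m f + ∑[ i < n ] f (m + i) + f (m + n)     ≡⟨ +-assoc (∑ m f) _ _ ⟩
  ∑ m f + ∑[ i < suc n ] f (m + i)             ∎
  where open ≡-Reasoning

∑-positive-≥-length : ∀ N {f : ℕ → ℕ} → (∀ {i} → i < N → 0 < f i) → N ≤ ∑ N f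
∑-positive-≥-length N {f} f>0 = begin
  N              ≡⟨ *-identityʳ N ⟨
  N * 1          ≡⟨ ∑-const N 1 ⟨
  ∑[ i < N ] 1   ≤⟨ ∑-mono-≤ N f>0 ⟩
  ∑ N f          ∎
  where open ≤-Reasoning

term-≤-∑ : ∀ {N i} (f : ℕ → ℕ) → i < N → f i ≤ ∑ N f
term-≤-∑ {suc N} f i<1+N with m<1+n⇒m<n∨m≡n i<1+N
... | inj₁ i<N  = ≤-trans (term-≤-∑ f i<N) (m≤m+n (∑ N f) (f N))
... | inj₂ refl = m≤n+m (f N) (∑ N f)

∑-pos⇒∃-pos : ∀ N {f : ℕ → ℕ} → 0 < ∑ N f → ∃[ i ] i < N × 0 < f i
∑-pos⇒∃-pos (suc N) {f} ∑>0 with 0 <? f N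
... | yes fN>0 = N , n<1+n N , fN>0
... | no  fN≯0 = let i , i<N , fi>0 = ∑-pos⇒∃-pos N ∑N>0 in i , m<n⇒m<1+n i<N , fi>0
  where
  ∑N>0 : 0 < ∑ N f
  ∑N>0 = subst (0 <_) (trans (cong (∑ N f +_) (n≤0⇒n≡0 (≮⇒≥ fN≯0))) (+-identityʳ _)) ∑>0

∑-≤1 : ∀ N {f : ℕ → ℕ} → (∀ {i} → i < N → f i ≤ 1) →
       (∀ {i j} → i < N → j < N → 0 < f i → 0 < f j → i ≡ j) → ∑ N f ≤ 1
∑-≤1 zero    _    _      = z≤n
∑-≤1 (suc N) {f} f≤1 unique with 0 <? ∑ N f
... | no  ∑≯0 = begin
  ∑ N f + f N ≡⟨ cong (_+ f N) (n≤0⇒n≡0 (≮⇒≥ ∑≯0)) ⟩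
  f N         ≤⟨ f≤1 (n<1+n N) ⟩
  1           ∎
  where open ≤-Reasoning
... | yes ∑>0 = begin
  ∑ N f + f N ≡⟨ cong (∑ N f +_) fN≡0 ⟩
  ∑ N f + 0   ≡⟨ +-identityʳ (∑ N f) ⟩
  ∑ N f       ≤⟨ ∑-≤1 N (f≤1 ∘′ m<n⇒m<1+n) (λ i<N j<N → unique (m<n⇒m<1+n i<N) (m<n⇒m<1+n j<N)) ⟩
  1           ∎
  where
  open ≤-Reasoning
  fN≡0 : f N ≡ 0
  fN≡0 with ∑-pos⇒∃-pos N ∑>0
  ... | i , i<N , fi>0 = n≤0⇒n≡0 (≮⇒≥ λ fN>0 →
    <-irrefl (unique (m<n⇒m<1+n i<N) (n<1+n N) fi>0 fN>0) i<N)

∑∑-≤1 : ∀ A B {h : ℕ → ℕ → ℕ} → (∀ s d → h s d ≤ 1) →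
        (∀ {s d s′ d′} → s < A → d < B → s′ < A → d′ < B →
          0 < h s d → 0 < h s′ d′ → s ≡ s′ × d ≡ d′) →
        ∑[ s < A ] ∑[ d < B ] h s d ≤ 1
∑∑-≤1 A B {h} h≤1 unique = ∑-≤1 A rowSum≤1 rowsUnique
  where
  rowSum≤1 : ∀ {s} → s < A → ∑[ d < B ] h s d ≤ 1
  rowSum≤1 s<A = ∑-≤1 B (λ {d} _ → h≤1 _ d) (λ d<B d′<B h>0 h′>0 →
    proj₂ (unique s<A d<B s<A d′<B h>0 h′>0))
  rowsUnique : ∀ {s s′} → s < A → s′ < A → 0 < ∑[ d < B ] h s d → 0 < ∑[ d < B ] h s′ d → s ≡ s′
  rowsUnique s<A s′<A row>0 row′>0 with ∑-pos⇒∃-pos B row>0 | ∑-pos⇒∃-pos B row′>0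
  ... | d , d<B , h>0 | d′ , d′<B , h′>0 = proj₁ (unique s<A d<B s′<A d′<B h>0 h′>0)

𝟙 : ∀ {P : Set} → Dec P → ℕ
𝟙 P? = if does P? then 1 else 0

𝟙-≤1 : ∀ {P : Set} (P? : Dec P) → 𝟙 P? ≤ 1
𝟙-≤1 (yes _) = ≤-refl
𝟙-≤1 (no  _) = z≤n

𝟙-sound : ∀ {P : Set} (P? : Dec P) → 0 < 𝟙 P? → P
𝟙-sound (yes p) _ = p

𝟙-pos : ∀ {P : Set} (P? : Dec P) → P → 0 < 𝟙 P?
𝟙-pos (yes _) _ = ≤-refl
𝟙-pos (no ¬p) p = contradiction p ¬p

𝟙-mono : ∀ {P Q : Set} → (P → Q) → (P? : Dec P) (Q? : Dec Q) → 𝟙 P? ≤ 𝟙 Q?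
𝟙-mono _   (yes _) (yes _) = ≤-refl
𝟙-mono P⇒Q (yes p) (no ¬q) = contradiction (P⇒Q p) ¬q
𝟙-mono _   (no  _) _       = z≤n

module _ {A B k : ℕ} {Q : ℕ → ℕ → Set} (Q? : ∀ s d → Dec (Q s d)) (κ : ℕ → ℕ → Fin k)
  (proper : ∀ {s d s′ d′} → s < A → d < B → s′ < A → d′ < B →
              Q s d → Q s′ d′ → κ s d ≡ κ s′ d′ → s ≡ s′ × d ≡ d′) where

  private
    coloured? : ∀ c s d → Dec (Q s d × toℕ (κ s d) ≡ c)
    coloured? c s d = Q? s d ×-dec toℕ (κ s d) ≟ c

    ofColour : ℕ → ℕ → ℕ → ℕ
    ofColour c s d = 𝟙 (coloured? c s d)

    colourClass-≤1 : ∀ c → ∑[ s < A ] ∑[ d < B ] ofColour c s d ≤ 1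
    colourClass-≤1 c = ∑∑-≤1 A B {ofColour c} (λ s d → 𝟙-≤1 (coloured? c s d)) sameColour
      where
      sameColour : ∀ {s d s′ d′} → s < A → d < B → s′ < A → d′ < B →
                   0 < ofColour c s d → 0 < ofColour c s′ d′ → s ≡ s′ × d ≡ d′
      sameColour {s} {d} {s′} {d′} s<A d<B s′<A d′<B h>0 h′>0
        with 𝟙-sound (coloured? c s d) h>0 | 𝟙-sound (coloured? c s′ d′) h′>0
      ... | q , κ≡c | q′ , κ′≡c =
        proper s<A d<B s′<A d′<B q q′ (toℕ-injective (trans κ≡c (sym κ′≡c)))

    𝟙-≤-∑-colours : ∀ s d → 𝟙 (Q? s d) ≤ ∑[ c < k ] ofColour c s d
    𝟙-≤-∑-colours s d = ≤-trans (𝟙-mono (_, refl) (Q? s d) (coloured? (toℕ (κ s d)) s d))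
                                  (term-≤-∑ (λ c → ofColour c s d) (toℕ<n (κ s d)))

  ∑∑-𝟙-≤-colours : ∑[ s < A ] ∑[ d < B ] 𝟙 (Q? s d) ≤ k
  ∑∑-𝟙-≤-colours = begin
    ∑[ s < A ] ∑[ d < B ] 𝟙 (Q? s d)
      ≤⟨ ∑-mono-≤ A (λ _ → ∑-mono-≤ B (λ _ → 𝟙-≤-∑-colours _ _)) ⟩
    ∑[ s < A ] ∑[ d < B ] ∑[ c < k ] ofColour c s d
      ≡⟨ ∑-cong A (λ s → ∑-comm B k (λ d c → ofColour c s d)) ⟩
    ∑[ s < A ] ∑[ c < k ] ∑[ d < B ] ofColour c s d
      ≡⟨ ∑-comm A k (λ s c → ∑[ d < B ] ofColour c s d) ⟩
    ∑[ c < k ] ∑[ s < A ] ∑[ d < B ] ofColour c s d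
      ≤⟨ ∑-mono-≤ k (λ _ → colourClass-≤1 _) ⟩
    ∑[ c < k ] 1
      ≡⟨ ∑-const k 1 ⟩
    k * 1
      ≡⟨ *-identityʳ k ⟩
    k ∎
    where open ≤-Reasoning

-- Walks in the cycle

walk-exits : ∀ {V : Set} {Adj : V → V → Set} {S : V → Set} → Decidable S →
             ∀ {p u v} → IsWalk Adj p → head p ≡ just u → last p ≡ just v → S u → ¬ S v →
             ∃[ x ] ∃[ y ] ConsecIn x y p × Adj x y × S x × ¬ S y
walk-exits S? [ _ ]                 refl refl Su ¬Sv = contradiction Su ¬Sv
walk-exits S? (_∷_ {x} {y} adj w) refl last≡v Sx ¬Sv with S? y
... | yes Sy = let x′ , y′ , x′y′∈p , rest = walk-exits S? w refl last≡v Sy ¬Sv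
               in x′ , y′ , there x′y′∈p , rest
... | no ¬Sy = x , y , here , adj , Sx , ¬Sy

module OnCycle (M : ℕ) .{{_ : NonZero M}} where

  Traverses : ℕ → Fin M → Fin M → Set
  Traverses e x y = toℕ x ≡ e × toℕ y ≡ suc e % M

  Joins : ℕ → Fin M → Fin M → Set
  Joins e x y = Traverses e x y ⊎ Traverses e y x

  Uses : ℕ → List (Fin M) → Set
  Uses e p = ∃[ x ] ∃[ y ] ConsecIn x y p × Joins e x y

  joins? : ∀ e x y → Dec (Joins e x y)
  joins? e x y = (toℕ x ≟ e ×-dec toℕ y ≟ suc e % M) ⊎-dec (toℕ y ≟ e ×-dec toℕ x ≟ suc e % M)

  uses? : ∀ e p → Dec (Uses e p)
  uses? e []          = no λ { (_ , _ , () , _) }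
  uses? e (x ∷ [])    = no λ { (_ , _ , there () , _) }
  uses? e (x ∷ y ∷ p) with joins? e x y | uses? e (y ∷ p)
  ... | yes xy | _                   = yes (x , y , here , xy)
  ... | no _   | yes (u , v , uv , J) = yes (u , v , there uv , J)
  ... | no ¬xy | no ¬rest            = no λ where
    (_ , _ , here , xy)    → ¬xy xy
    (u , v , there uv , J) → ¬rest (u , v , uv , J)

  traverses-unique : ∀ {e x y x′ y′} → Traverses e x y → Traverses e x′ y′ → x ≡ x′ × y ≡ y′
  traverses-unique (x≡e , y≡e+1) (x′≡e , y′≡e+1) =
    toℕ-injective (trans x≡e (sym x′≡e)) , toℕ-injective (trans y≡e+1 (sym y′≡e+1))

  joins-unique : ∀ {e x y x′ y′} → Joins e x y → Joins e x′ y′ →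
                 (x ≡ x′ × y ≡ y′) ⊎ (x ≡ y′ × y ≡ x′)
  joins-unique (inj₁ t) (inj₁ t′) = inj₁ (traverses-unique t t′)
  joins-unique (inj₁ t) (inj₂ t′) = inj₂ (traverses-unique t t′)
  joins-unique (inj₂ t) (inj₁ t′) = inj₂ (swap (traverses-unique t t′))
  joins-unique (inj₂ t) (inj₂ t′) = inj₁ (swap (traverses-unique t t′))

  uses⇒SharesEdge : ∀ {e p q} → Uses e p → Uses e q → SharesEdge p q
  uses⇒SharesEdge (x , y , xy∈p , J) (x′ , y′ , x′y′∈q , J′) with joins-unique J J′
  ... | inj₁ (refl , refl) = x , y , xy∈p , inj₁ x′y′∈q
  ... | inj₂ (refl , refl) = x , y , xy∈p , inj₂ x′y′∈q

  -- The vertices i + 1, …, j: the arc cut off by the edges i and j.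
  InArc : ℕ → ℕ → ℕ → Set
  InArc i j v = i < v × v ≤ j

  inArc? : ∀ i j v → Dec (InArc i j v)
  inArc? i j v = i <? v ×-dec v ≤? j

  suc-%-cases : ∀ {u} → u < M → (suc u < M × suc u % M ≡ suc u) ⊎ (suc u ≡ M × suc u % M ≡ 0)
  suc-%-cases {u} u<M with m≤n⇒m<n∨m≡n u<M
  ... | inj₁ 1+u<M = inj₁ (1+u<M , m<n⇒m%n≡m 1+u<M)
  ... | inj₂ 1+u≡M = inj₂ (1+u≡M , trans (cong (_% M) 1+u≡M) (n%n≡0 M))

  arc-exit : ∀ {i j u} → j < M → u < M → InArc i j u → ¬ InArc i j (suc u % M) → u ≡ j
  arc-exit {i} {j} {u} j<M u<M (i<u , u≤j) next∉ with suc-%-cases u<M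
  ... | inj₁ (_ , next≡1+u) = ≤-antisym u≤j (≤-pred (≰⇒> λ 1+u≤j →
          next∉ (subst (InArc i j) (sym next≡1+u) (m<n⇒m<1+n i<u , 1+u≤j))))
  ... | inj₂ (1+u≡M , _) = ≤-antisym u≤j (≤-pred (subst (j <_) (sym 1+u≡M) j<M))

  arc-entry : ∀ {i j u} → u < M → ¬ InArc i j u → InArc i j (suc u % M) → u ≡ i
  arc-entry {i} {j} {u} u<M u∉ next∈ with suc-%-cases u<M
  ... | inj₁ (_ , next≡1+u) =
          let i<1+u , 1+u≤j = subst (InArc i j) next≡1+u next∈
          in ≤-antisym (≮⇒≥ λ i<u → u∉ (i<u , <⇒≤ 1+u≤j)) (≤-pred i<1+u)
  ... | inj₂ (_ , next≡0) = contradiction (proj₁ (subst (InArc i j) next≡0 next∈)) n≮0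

  leaves-arc : ∀ {i j} {x y : Fin M} → j < M → CycleAdj M x y →
               InArc i j (toℕ x) → ¬ InArc i j (toℕ y) → Joins i x y ⊎ Joins j x y
  leaves-arc {i} {j} {x} {y} j<M (inj₁ y≡x+1) x∈ y∉ =
    inj₂ (inj₁ (x≡j , trans y≡x+1 (cong (λ v → suc v % M) x≡j)))
    where
    x≡j : toℕ x ≡ j
    x≡j = arc-exit j<M (toℕ<n x) x∈ (λ x+1∈ → y∉ (subst (InArc i j) (sym y≡x+1) x+1∈))
  leaves-arc {i} {j} {x} {y} j<M (inj₂ x≡y+1) x∈ y∉ =
    inj₁ (inj₂ (y≡i , trans x≡y+1 (cong (λ v → suc v % M) y≡i)))
    where
    y≡i : toℕ y ≡ i
    y≡i = arc-entry (toℕ<n y) y∉ (subst (InArc i j) x≡y+1 x∈)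

  enters-arc : ∀ {i j} {x y : Fin M} → j < M → CycleAdj M x y →
               ¬ InArc i j (toℕ x) → InArc i j (toℕ y) → Joins i x y ⊎ Joins j x y
  enters-arc j<M x~y x∉ y∈ = Sum.map Sum.swap Sum.swap (leaves-arc j<M (Sum.swap x~y) y∈ x∉)

  module _ {i j : ℕ} (j<M : j < M) {p : List (Fin M)} {u v : Fin M}
           (walk : IsWalk (CycleAdj M) p) (head≡u : head p ≡ just u) (last≡v : last p ≡ just v)
           where

    walk-leaving-arc : InArc i j (toℕ u) → ¬ InArc i j (toℕ v) → Uses i p ⊎ Uses j p
    walk-leaving-arc u∈ v∉
      with walk-exits (λ x → inArc? i j (toℕ x)) walk head≡u last≡v u∈ v∉
    ... | x , y , xy∈p , x~y , x∈ , y∉ =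
      Sum.map (λ J → x , y , xy∈p , J) (λ J → x , y , xy∈p , J) (leaves-arc j<M x~y x∈ y∉)

    walk-entering-arc : ¬ InArc i j (toℕ u) → InArc i j (toℕ v) → Uses i p ⊎ Uses j p
    walk-entering-arc u∉ v∈
      with walk-exits (λ x → ¬? (inArc? i j (toℕ x))) walk head≡u last≡v u∉ (λ v∉ → v∉ v∈)
    ... | x , y , xy∈p , x~y , x∉ , ¬y∉ =
      Sum.map (λ J → x , y , xy∈p , J) (λ J → x , y , xy∈p , J)
              (enters-arc j<M x~y x∉ (decidable-stable (inArc? i j (toℕ y)) ¬y∉))

  edgesUsed : List (Fin M) → ℕ
  edgesUsed p = ∑[ e < M ] 𝟙 (uses? e p)

  module _ {a L R : ℕ} (a+L+R≡M : a + L + R ≡ M) {p : List (Fin M)} {u v : Fin M}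
           (walk : IsWalk (CycleAdj M) p) (head≡u : head p ≡ just u) (last≡v : last p ≡ just v)
           (u≡a : toℕ u ≡ a) (v≡a+L : toℕ v ≡ a + L) where

    private
      used : ℕ → ℕ
      used e = 𝟙 (uses? e p)

      counted : ∀ {e} → Uses e p → 0 < used e
      counted = 𝟙-pos (uses? _ p)

      edgesUsed-split :
        edgesUsed p ≡ ∑ a used + ∑[ t < L ] used (a + t) + ∑[ r < R ] used (a + L + r)
      edgesUsed-split = begin
        ∑ M used
          ≡⟨ cong (λ m → ∑ m used) a+L+R≡M ⟨
        ∑ (a + L + R) used
          ≡⟨ ∑-split (a + L) R used ⟩
        ∑ (a + L) used + ∑[ r < R ] used (a + L + r)
          ≡⟨ cong (_+ ∑[ r < R ] used (a + L + r)) (∑-split a L used) ⟩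
        ∑ a used + ∑[ t < L ] used (a + t) + ∑[ r < R ] used (a + L + r) ∎
        where open ≡-Reasoning

      module _ {t : ℕ} (t<L : t < L) (gap : ¬ Uses (a + t) p) where

        a+t<a+L : a + t < a + L
        a+t<a+L = +-monoʳ-< a t<L

        a+t<M : a + t < M
        a+t<M = <-≤-trans a+t<a+L (subst (a + L ≤_) a+L+R≡M (m≤m+n (a + L) R))

        uses-below : ∀ {e} → e < a → Uses e p
        uses-below {e} e<a = Sum.[ id , flip contradiction gap ]
          (walk-leaving-arc {e} {a + t} a+t<M walk head≡u last≡v u∈ v∉)
          where
          u∈ : InArc e (a + t) (toℕ u)
          u∈ = subst (InArc e (a + t)) (sym u≡a) (e<a , m≤m+n a t)
          v∉ : ¬ InArc e (a + t) (toℕ v)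
          v∉ (_ , v≤a+t) = <⇒≱ a+t<a+L (subst (_≤ a + t) v≡a+L v≤a+t)

        uses-above : ∀ {r} → r < R → Uses (a + L + r) p
        uses-above {r} r<R = Sum.[ flip contradiction gap , id ]
          (walk-entering-arc {a + t} {a + L + r} j<M walk head≡u last≡v u∉ v∈)
          where
          j<M : a + L + r < M
          j<M = subst (a + L + r <_) a+L+R≡M (+-monoʳ-< (a + L) r<R)
          u∉ : ¬ InArc (a + t) (a + L + r) (toℕ u)
          u∉ (a+t<u , _) = <⇒≱ (subst (a + t <_) u≡a a+t<u) (m≤m+n a t)
          v∈ : InArc (a + t) (a + L + r) (toℕ v)
          v∈ = subst (InArc (a + t) (a + L + r)) (sym v≡a+L) (a+t<a+L , m≤m+n (a + L) r)

    walk-edgesUsed-≥ : L ≤ edgesUsed p ⊎ a + R ≤ edgesUsed p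
    walk-edgesUsed-≥ with anyUpTo? (λ t → ¬? (uses? (a + t) p)) L
    ... | no noGap = inj₁ (begin
      L
        ≤⟨ ∑-positive-≥-length L (counted ∘′ uses-inner) ⟩
      ∑[ t < L ] used (a + t)
        ≤⟨ m≤n+m _ (∑ a used) ⟩
      ∑ a used + ∑[ t < L ] used (a + t)
        ≤⟨ m≤m+n _ (∑[ r < R ] used (a + L + r)) ⟩
      ∑ a used + ∑[ t < L ] used (a + t) + ∑[ r < R ] used (a + L + r)
        ≡⟨ edgesUsed-split ⟨
      edgesUsed p ∎)
      where
      open ≤-Reasoning
      uses-inner : ∀ {t} → t < L → Uses (a + t) p
      uses-inner {t} t<L = decidable-stable (uses? (a + t) p) λ gap → noGap (t , t<L , gap)
    ... | yes (t , t<L , gap) = inj₂ (begin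
      a + R
        ≤⟨ +-mono-≤ (∑-positive-≥-length a (counted ∘′ uses-below t<L gap))
                    (∑-positive-≥-length R (counted ∘′ uses-above t<L gap)) ⟩
      ∑ a used + ∑[ r < R ] used (a + L + r)
        ≤⟨ +-monoˡ-≤ (∑[ r < R ] used (a + L + r)) (m≤m+n _ _) ⟩
      ∑ a used + ∑[ t < L ] used (a + t) + ∑[ r < R ] used (a + L + r)
        ≡⟨ edgesUsed-split ⟨
      edgesUsed p ∎)
      where open ≤-Reasoning

-- Chords of the odd cycle

toℕ-mod : ∀ {x m} .{{_ : NonZero m}} → x < m → toℕ (x mod m) ≡ x
toℕ-mod x<m = trans (toℕ-fromℕ< _) (m<n⇒m%n≡m x<m)

mod-injective : ∀ {x y m} .{{_ : NonZero m}} → x < m → y < m → x mod m ≡ y mod m → x ≡ y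
mod-injective x<m y<m eq = trans (sym (toℕ-mod x<m)) (trans (cong toℕ eq) (toℕ-mod y<m))

module OddCycle (n : ℕ) where

  M : ℕ
  M = suc (2 * n)

  short+short<M : ∀ {δ δ′} → δ ≤ n → δ′ ≤ n → δ + δ′ < M
  short+short<M δ≤n δ′≤n = s≤s (+-mono-≤ δ≤n (≤-trans δ′≤n (m≤m+n n 0)))

  short≤complement : ∀ {x δ} → δ ≤ n → x + δ ≡ M → δ ≤ x
  short≤complement {x} {δ} δ≤n x+δ≡M =
    <⇒≤ (+-cancelʳ-< δ δ x (subst (δ + δ <_) (sym x+δ≡M) (short+short<M δ≤n δ≤n)))

  -- The ends s and (s + δ) mod M of a chord, in increasing order.
  chord : ℕ → ℕ → ℕ × ℕ
  chord s δ with s + δ <? M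
  ... | yes _ = s , s + δ
  ... | no  _ = s + δ ∸ M , s

  -- The ends a and b cut C_M into arcs with L and a + R edges, both at least δ long.
  record IsChord (δ a b : ℕ) : Set where
    field
      L R   : ℕ
      a+L≡b : a + L ≡ b
      b+R≡M : b + R ≡ M
      b<M   : b < M
      δ≤L   : δ ≤ L
      δ≤a+R : δ ≤ a + R

    a+L+R≡M : a + L + R ≡ M
    a+L+R≡M = trans (cong (_+ R) a+L≡b) b+R≡M

    a<M : a < M
    a<M = ≤-<-trans (subst (a ≤_) a+L≡b (m≤m+n a L)) b<M

    a<b : 0 < δ → a < b
    a<b δ>0 = subst (a <_) a+L≡b (m<m+n a (<-≤-trans δ>0 δ≤L))

  chord-isChord : ∀ {s δ} → s < M → δ ≤ n → uncurry (IsChord δ) (chord s δ)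
  chord-isChord {s} {δ} s<M δ≤n with s + δ <? M
  ... | yes s+δ<M = record
    { L = δ ; R = R ; a+L≡b = refl ; b+R≡M = s+δ+R≡M ; b<M = s+δ<M ; δ≤L = ≤-refl
    ; δ≤a+R = short≤complement δ≤n s+R+δ≡M
    }
    where
    R : ℕ
    R = M ∸ (s + δ)
    s+δ+R≡M : s + δ + R ≡ M
    s+δ+R≡M = m+[n∸m]≡n (<⇒≤ s+δ<M)
    s+R+δ≡M : s + R + δ ≡ M
    s+R+δ≡M = trans (xy∙z≈xz∙y s R δ) s+δ+R≡M
  ... | no  s+δ≮M = record
    { L = L ; R = R ; a+L≡b = a+L≡s ; b+R≡M = s+R≡M ; b<M = s<M
    ; δ≤L = short≤complement δ≤n L+δ≡M ; δ≤a+R = ≤-reflexive (sym a+R≡δ)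
    }
    where
    a L R : ℕ
    a = s + δ ∸ M
    L = M ∸ δ
    R = M ∸ s
    a+M≡s+δ : a + M ≡ s + δ
    a+M≡s+δ = m∸n+n≡m (≮⇒≥ s+δ≮M)
    L+δ≡M : L + δ ≡ M
    L+δ≡M = m∸n+n≡m (≤-trans (m≤m+n δ δ) (<⇒≤ (short+short<M δ≤n δ≤n)))
    s+R≡M : s + R ≡ M
    s+R≡M = m+[n∸m]≡n (<⇒≤ s<M)
    a+L≡s : a + L ≡ s
    a+L≡s = +-cancelʳ-≡ δ (a + L) s (begin
      a + L + δ   ≡⟨ +-assoc a L δ ⟩
      a + (L + δ) ≡⟨ cong (a +_) L+δ≡M ⟩
      a + M       ≡⟨ a+M≡s+δ ⟩
      s + δ       ∎)
      where open ≡-Reasoning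
    a+R≡δ : a + R ≡ δ
    a+R≡δ = +-cancelʳ-≡ s (a + R) δ (begin
      a + R + s   ≡⟨ +-assoc a R s ⟩
      a + (R + s) ≡⟨ cong (a +_) (trans (+-comm R s) s+R≡M) ⟩
      a + M       ≡⟨ a+M≡s+δ ⟩
      s + δ       ≡⟨ +-comm s δ ⟩
      δ + s       ∎)
      where open ≡-Reasoning

  wrapped≢unwrapped : ∀ {s δ s′ δ′} → ¬ s + δ < M → δ ≤ n → δ′ ≤ n →
                      ¬ (s′ ≡ s + δ ∸ M × s′ + δ′ ≡ s)
  wrapped≢unwrapped {s} {δ} {s′} {δ′} s+δ≮M δ≤n δ′≤n (s′≡a , s′+δ′≡s) =
    <-irrefl (sym (+-cancelˡ-≡ s′ M (δ′ + δ) s′+M≡s′+δ′+δ)) (short+short<M δ′≤n δ≤n)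
    where
    open ≡-Reasoning
    s′+M≡s′+δ′+δ : s′ + M ≡ s′ + (δ′ + δ)
    s′+M≡s′+δ′+δ = begin
      s′ + M          ≡⟨ cong (_+ M) s′≡a ⟩
      s + δ ∸ M + M   ≡⟨ m∸n+n≡m (≮⇒≥ s+δ≮M) ⟩
      s + δ           ≡⟨ cong (_+ δ) s′+δ′≡s ⟨
      s′ + δ′ + δ     ≡⟨ +-assoc s′ δ′ δ ⟩
      s′ + (δ′ + δ)   ∎

  chord-injective : ∀ {s δ s′ δ′} → δ ≤ n → δ′ ≤ n → chord s δ ≡ chord s′ δ′ → s ≡ s′ × δ ≡ δ′
  chord-injective {s} {δ} {s′} {δ′} δ≤n δ′≤n eq with s + δ <? M | s′ + δ′ <? M
  ... | yes _ | yes _ = let s≡s′ , s+δ≡s′+δ′ = ×-≡,≡←≡ eq in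
    s≡s′ , +-cancelˡ-≡ s δ δ′ (trans s+δ≡s′+δ′ (cong (_+ δ′) (sym s≡s′)))
  ... | no s+δ≮M | no s′+δ′≮M = let a≡a′ , s≡s′ = ×-≡,≡←≡ eq in
    s≡s′ , +-cancelˡ-≡ s δ δ′
             (trans (∸-cancelʳ-≡ (≮⇒≥ s+δ≮M) (≮⇒≥ s′+δ′≮M) a≡a′) (cong (_+ δ′) (sym s≡s′)))
  ... | yes _ | no s′+δ′≮M = contradiction (×-≡,≡←≡ eq) (wrapped≢unwrapped s′+δ′≮M δ′≤n δ≤n)
  ... | no s+δ≮M | yes _ = contradiction (×-≡,≡←≡ (sym eq)) (wrapped≢unwrapped s+δ≮M δ≤n δ′≤n)

  _≟ends_ : DecidableEquality (Fin M × Fin M)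
  _≟ends_ = ≡-dec _≟ᶠ_ _≟ᶠ_

  chordEnds : ℕ → ℕ → Fin M × Fin M
  chordEnds s δ = Prod.map (_mod M) (_mod M) (chord s δ)

  chordEnds-ordered : ∀ {s δ} → s < M → 0 < δ → δ ≤ n →
                      proj₁ (chordEnds s δ) <ᶠ proj₂ (chordEnds s δ)
  chordEnds-ordered {s} {δ} s<M δ>0 δ≤n =
    subst₂ _<_ (sym (toℕ-mod a<M)) (sym (toℕ-mod b<M)) (a<b δ>0)
    where
    c : uncurry (IsChord δ) (chord s δ)
    c = chord-isChord s<M δ≤n
    open IsChord c

  chordEnds-injective : ∀ {s δ s′ δ′} → s < M → s′ < M → δ ≤ n → δ′ ≤ n →
                        chordEnds s δ ≡ chordEnds s′ δ′ → s ≡ s′ × δ ≡ δ′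
  chordEnds-injective {s} {δ} {s′} {δ′} s<M s′<M δ≤n δ′≤n eq with ×-≡,≡←≡ eq
  ... | a≡a′ , b≡b′ = chord-injective δ≤n δ′≤n (×-≡,≡→≡
    ( mod-injective (IsChord.a<M c) (IsChord.a<M c′) a≡a′
    , mod-injective (IsChord.b<M c) (IsChord.b<M c′) b≡b′ ))
    where
    c : uncurry (IsChord δ) (chord s δ)
    c = chord-isChord s<M δ≤n
    c′ : uncurry (IsChord δ′) (chord s′ δ′)
    c′ = chord-isChord s′<M δ′≤n

  open OnCycle M

  chordColour : ∀ {k} → (Fin M → Fin M → Fin k) → ℕ → ℕ → Fin k
  chordColour ω s δ = uncurry ω (chordEnds s δ)

  module _ (𝒫 : PathSystem M) where
    open PathSystem 𝒫

    chordPath : ℕ → ℕ → List (Fin M)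
    chordPath s δ = uncurry path (chordEnds s δ)

    chordPath-edgesUsed : ∀ {s δ} → s < M → 0 < δ → δ ≤ n → δ ≤ edgesUsed (chordPath s δ)
    chordPath-edgesUsed {s} {δ} s<M δ>0 δ≤n
      with walk , _ , head≡a , last≡b ← valid _ _ (chordEnds-ordered s<M δ>0 δ≤n)
      = Sum.[ ≤-trans δ≤L , ≤-trans δ≤a+R ]
          (walk-edgesUsed-≥ a+L+R≡M walk head≡a last≡b
                            (toℕ-mod a<M) (trans (toℕ-mod b<M) (sym a+L≡b)))
      where
      c : uncurry (IsChord δ) (chord s δ)
      c = chord-isChord s<M δ≤n
      open IsChord c

    module _ {k : ℕ} {ω : Fin M → Fin M → Fin k} (packing : IsGlobalPacking M 𝒫 k ω) where

      chords-properlyColoured : ∀ e {s d s′ d′} → s < M → d < n → s′ < M → d′ < n →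
                                Uses e (chordPath s (suc d)) → Uses e (chordPath s′ (suc d′)) →
                                chordColour ω s (suc d) ≡ chordColour ω s′ (suc d′) →
                                s ≡ s′ × d ≡ d′
      chords-properlyColoured e {s} {d} {s′} {d′} s<M d<n s′<M d′<n uses uses′ sameColour
        with chordEnds s (suc d) ≟ends chordEnds s′ (suc d′)
      ... | yes sameEnds = Prod.map₂ suc-injective (chordEnds-injective s<M s′<M d<n d′<n sameEnds)
      ... | no  otherEnds = contradiction sameColour
            (packing _ _ _ _ (chordEnds-ordered s<M z<s d<n) (chordEnds-ordered s′<M z<s d′<n)
                     (otherEnds ∘′ ×-≡,≡→≡) (uses⇒SharesEdge uses uses′))

      chordPaths-using-≤-colours : ∀ e → ∑[ s < M ] ∑[ d < n ] 𝟙 (uses? e (chordPath s (suc d))) ≤ k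
      chordPaths-using-≤-colours e =
        ∑∑-𝟙-≤-colours (λ s d → uses? e (chordPath s (suc d))) (λ s d → chordColour ω s (suc d))
                       (chords-properlyColoured e)

∑[d<n]1+d≡[1+n]C2 : ∀ n → ∑[ d < n ] suc d ≡ suc n C 2
∑[d<n]1+d≡[1+n]C2 zero    = refl
∑[d<n]1+d≡[1+n]C2 (suc n) = begin
  ∑[ d < n ] suc d + suc n      ≡⟨ cong (_+ suc n) (∑[d<n]1+d≡[1+n]C2 n) ⟩
  suc n C 2 + suc n             ≡⟨ +-comm (suc n C 2) (suc n) ⟩
  suc n + suc n C 2             ≡⟨ cong (_+ suc n C 2) (nC1≡n (suc n)) ⟨
  suc n C 1 + suc n C 2         ≡⟨ nCk+nC[k+1]≡[n+1]C[k+1] (suc n) 1 ⟩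
  suc (suc n) C 2               ∎
  where open ≡-Reasoning

lemma3 : (n : ℕ) → 1 ≤ n → (𝒫 : PathSystem (suc (2 * n))) → (k : ℕ) →
         (ω : Fin (suc (2 * n)) → Fin (suc (2 * n)) → Fin k) →
         IsGlobalPacking (suc (2 * n)) 𝒫 k ω → suc n C 2 ≤ k
lemma3 n _ 𝒫 k ω packing = *-cancelˡ-≤ M (begin
  M * (suc n C 2)
    ≡⟨ cong (M *_) (∑[d<n]1+d≡[1+n]C2 n) ⟨
  M * ∑[ d < n ] suc d
    ≡⟨ ∑-const M (∑[ d < n ] suc d) ⟨
  ∑[ s < M ] ∑[ d < n ] suc d
    ≤⟨ ∑-mono-≤ M (λ s<M → ∑-mono-≤ n (λ d<n → chordPath-edgesUsed 𝒫 s<M z<s d<n)) ⟩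
  ∑[ s < M ] ∑[ d < n ] ∑[ e < M ] uses e s d
    ≡⟨ ∑-cong M (λ s → ∑-comm n M (λ d e → uses e s d)) ⟩
  ∑[ s < M ] ∑[ e < M ] ∑[ d < n ] uses e s d
    ≡⟨ ∑-comm M M (λ s e → ∑[ d < n ] uses e s d) ⟩
  ∑[ e < M ] ∑[ s < M ] ∑[ d < n ] uses e s d
    ≤⟨ ∑-mono-≤ M (λ _ → chordPaths-using-≤-colours 𝒫 packing _) ⟩
  ∑[ e < M ] k
    ≡⟨ ∑-const M k ⟩
  M * k ∎)
  where
  open OddCycle n
  open OnCycle M
  open ≤-Reasoning
  uses : ℕ → ℕ → ℕ → ℕ
  uses e s d = 𝟙 (uses? e (chordPath 𝒫 s (suc d)))
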